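{- For all integers $N,a\ge0$, $$\Delta p(2N-2a,4,N)=\Delta_{a+1}p(N-a,3)\qquad\text{and}\qquad \Delta p\bigl(2N-(2a+1),4,N\bigr)=\Delta_a p(N-2-a,3).$$
   Context: $p(n,m,N)$ is the number of partitions of $n$ into at most $m$ parts, each at most $N$ (the coefficient of $q^n$ in the Gaussian polynomial $\begin{bmatrix}N+m\\ m\end{bmatrix}_q$); $p(n,m)$ is the number of partitions of $n$ into at most $m$ parts; both are $0$ for $n<0$ and $p(0,m)=1$. For an integer $x$: $\Delta_x p(n,m)=p(n,m)-p(n-x,m)$ and $\Delta_x p(n,m,N)=p(n,m,N)-p(n-x,m,N)$; $\Delta$ without subscript means $\Delta_1$, and $\Delta_0$ is identically $0$. -}

module Defs where

open import Data.Nat using (ℕ; zero; suc; _+_; _*_; _∸_; _≤?_)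
open import Data.Integer as ℤ using (ℤ; +_; -[1+_])
open import Relation.Nullary using (yes; no)

-- pb n m k = number of partitions of the natural number n into at most m
-- parts, each part at most k.  Recursion on the bound k: choose the
-- multiplicity j (0 ≤ j ≤ m) of the part k+1, then partition the rest
-- into at most m ∸ j parts each at most k.
pb : ℕ → ℕ → ℕ → ℕ
pbSum : ℕ → ℕ → ℕ → ℕ → ℕ

pb zero    m zero    = 1
pb (suc n) m zero    = 0
pb n       m (suc k) = pbSum n m k m

pbSum n m k zero = pb n m k
pbSum n m k (suc j) with suc j * suc k ≤? n
... | yes _ = pb (n ∸ suc j * suc k) (m ∸ suc j) k + pbSum n m k j
... | no  _ = pbSum n m k j

-- p(n,m,N): partitions of the integer n into at most m parts, each ≤ N;
-- zero for negative n.
pmN : ℤ → ℕ → ℕ → ℤ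
pmN (+ n)    m N = + pb n m N
pmN -[1+ _ ] m N = + 0

-- p(n,m): partitions of n into at most m parts (parts of a partition of
-- n are automatically ≤ n); zero for negative n.
pm : ℤ → ℕ → ℤ
pm (+ n)    m = + pb n m n
pm -[1+ _ ] m = + 0

Δp : ℤ → ℤ → ℕ → ℤ
Δp x n m = pm n m ℤ.- pm (n ℤ.- x) m

ΔpN : ℤ → ℤ → ℕ → ℕ → ℤ
ΔpN x n m N = pmN n m N ℤ.- pmN (n ℤ.- x) m N

-- Sorting the partitions of x into at most four parts by their largest part ℓ: those with ℓ > N
-- become, after removing ℓ, partitions of x − ℓ into at most three parts, and for x ≤ 2N + 2 the
-- rest is automatically at most ℓ.  Hence p(x,4,N) = p(x,4) − Σ_{0≤j<x−N} p(j,3), and so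
-- Δp(x,4,N) = Δp(x,4) − p(x−N−1,3).  Next, Δp(·,4) counts partitions into parts 2, 3, 4, with
-- generating function (1+q³)/((1−q²)(1−q⁴)(1−q⁶)); thus Δp(2y,4) = p(y,3) and
-- Δp(2y−1,4) = p(y−2,3).  These two parity identities are proved by induction on y from the
-- recurrences Δ_m p(·,m) = p(·,m−1), after which x = 2N−2a and x = 2N−2a−1 give the theorem.
module Submission where

open import Defs
open import Data.Nat as ℕ using (ℕ; zero; suc; _∸_; s≤s; z≤n; _≤?_)
open import Data.Nat.Properties as ℕ
  using ( *-identityˡ; +-comm; +-monoʳ-≤; +-cancelˡ-≤; m≤m+n; m≤n+m; m+n∸m≡n; [m+n]∸[m+o]≡n∸o
        ; <⇒≱; ≰⇒>; ≤-trans; n≤1+n; m≤n⇒∃[o]m+o≡n; m≤n⇒m<n∨m≡n )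
open import Data.Integer as ℤ using (ℤ; +_; -[1+_]; _+_; _-_; _*_; -_; +≤+)
import Data.Integer.Properties as ℤ
open import Data.Integer.Tactic.RingSolver using (solve-∀)
open import Data.Product using (_×_; _,_; proj₁; proj₂)
open import Data.Sum using (inj₁; inj₂)
open import Function using (_∘_)
open import Relation.Nullary using (yes; no; ¬_)
open import Relation.Nullary.Negation using (contradiction)
open import Relation.Binary.PropositionalEquality
  using (_≡_; refl; sym; trans; cong; cong₂; subst; module ≡-Reasoning)
open import Algebra.Properties.CommutativeSemigroup ℕ.+-commutativeSemigroup using (x∙yz≈y∙xz)
open import Algebra.Properties.CommutativeSemigroup ℤ.+-commutativeSemigroup
  using (interchange; xy∙z≈x∙zy)

-- Recurrences of the Gaussian coefficients p(x, m, k)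

pbSum-suc-≤ : ∀ {n} m k j → suc j ℕ.* suc k ℕ.≤ n →
  pbSum n m k (suc j) ≡ pb (n ∸ suc j ℕ.* suc k) (m ∸ suc j) k ℕ.+ pbSum n m k j
pbSum-suc-≤ {n} m k j le with suc j ℕ.* suc k ≤? n
... | yes _ = refl
... | no ¬le = contradiction le ¬le

pbSum-suc-≰ : ∀ {n} m k j → ¬ suc j ℕ.* suc k ℕ.≤ n → pbSum n m k (suc j) ≡ pbSum n m k j
pbSum-suc-≰ {n} m k j ¬le with suc j ℕ.* suc k ≤? n
... | yes le = contradiction le ¬le
... | no _ = refl

pbSum-below : ∀ {n} m k j → n ℕ.≤ k → pbSum n m k j ≡ pb n m k
pbSum-below m k zero n≤k = refl
pbSum-below m k (suc j) n≤k =
  trans (pbSum-suc-≰ m k j (λ le → <⇒≱ (s≤s n≤k) (≤-trans (m≤m+n (suc k) _) le)))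
        (pbSum-below m k j n≤k)

pbSum-shift : ∀ r m k j →
  pbSum (suc k ℕ.+ r) (suc m) k (suc j) ≡ pb (suc k ℕ.+ r) (suc m) k ℕ.+ pbSum r m k j
pbSum-shift r m k zero = begin
  pbSum (suc k ℕ.+ r) (suc m) k 1
    ≡⟨ pbSum-suc-≤ (suc m) k 0 (subst (ℕ._≤ suc k ℕ.+ r) (sym 1*k≡k) (m≤m+n (suc k) r)) ⟩
  pb (suc k ℕ.+ r ∸ 1 ℕ.* suc k) m k ℕ.+ pb (suc k ℕ.+ r) (suc m) k
    ≡⟨ cong (λ n → pb n m k ℕ.+ pb (suc k ℕ.+ r) (suc m) k) k+r∸1*k≡r ⟩
  pb r m k ℕ.+ pb (suc k ℕ.+ r) (suc m) k
    ≡⟨ +-comm (pb r m k) _ ⟩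
  pb (suc k ℕ.+ r) (suc m) k ℕ.+ pb r m k ∎
  where
  open ≡-Reasoning
  1*k≡k : 1 ℕ.* suc k ≡ suc k
  1*k≡k = *-identityˡ (suc k)
  k+r∸1*k≡r : suc k ℕ.+ r ∸ 1 ℕ.* suc k ≡ r
  k+r∸1*k≡r = trans (cong (suc k ℕ.+ r ∸_) 1*k≡k) (m+n∸m≡n (suc k) r)
pbSum-shift r m k (suc j) with suc j ℕ.* suc k ≤? r
... | yes jk≤r = begin
  pbSum (suc k ℕ.+ r) (suc m) k (2 ℕ.+ j)
    ≡⟨ pbSum-suc-≤ (suc m) k (suc j) (+-monoʳ-≤ (suc k) jk≤r) ⟩
  pb (suc k ℕ.+ r ∸ (suc k ℕ.+ jk)) (m ∸ suc j) k ℕ.+ pbSum (suc k ℕ.+ r) (suc m) k (suc j)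
    ≡⟨ cong₂ ℕ._+_ (cong (λ n → pb n (m ∸ suc j) k) ([m+n]∸[m+o]≡n∸o (suc k) r jk))
                   (pbSum-shift r m k j) ⟩
  pb (r ∸ jk) (m ∸ suc j) k ℕ.+ (pb (suc k ℕ.+ r) (suc m) k ℕ.+ pbSum r m k j)
    ≡⟨ x∙yz≈y∙xz (pb (r ∸ jk) (m ∸ suc j) k) (pb (suc k ℕ.+ r) (suc m) k) (pbSum r m k j) ⟩
  pb (suc k ℕ.+ r) (suc m) k ℕ.+ (pb (r ∸ jk) (m ∸ suc j) k ℕ.+ pbSum r m k j) ∎
  where
  open ≡-Reasoning
  jk : ℕ
  jk = suc j ℕ.* suc k
... | no jk≰r = trans (pbSum-suc-≰ (suc m) k (suc j) (jk≰r ∘ +-cancelˡ-≤ (suc k) _ _))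
                      (pbSum-shift r m k j)

pb-unfold : ∀ n m k → pb n m (suc k) ≡ pbSum n m k m
pb-unfold zero    m k = refl
pb-unfold (suc n) m k = refl

pb-pascal-bound : ∀ r m k →
  pb (suc k ℕ.+ r) (suc m) (suc k) ≡ pb (suc k ℕ.+ r) (suc m) k ℕ.+ pb r m (suc k)
pb-pascal-bound r m k =
  trans (pbSum-shift r m k m) (cong (pb (suc k ℕ.+ r) (suc m) k ℕ.+_) (sym (pb-unfold r m k)))

pb-suc-bound : ∀ {n k} m → n ℕ.≤ k → pb n m (suc k) ≡ pb n m k
pb-suc-bound {n} {k} m n≤k = trans (pb-unfold n m k) (pbSum-below m k m n≤k)

pb-stable : ∀ {n K} m → n ℕ.≤ K → pb n m K ≡ pb n m n
pb-stable {K = zero}  m z≤n = refl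
pb-stable {K = suc K} m n≤1+K with m≤n⇒m<n∨m≡n n≤1+K
... | inj₁ (s≤s n≤K) = trans (pb-suc-bound m n≤K) (pb-stable m n≤K)
... | inj₂ refl      = refl

pb-no-parts : ∀ n k → pb (suc n) 0 k ≡ 0
pb-no-parts n zero    = refl
pb-no-parts n (suc k) = pb-no-parts n k

pmN-below-zero : ∀ {n l} m k → n ℕ.< l → pmN (+ n - + l) m k ≡ + 0
pmN-below-zero {n} m k n<l with m≤n⇒∃[o]m+o≡n n<l
... | e , refl = cong (λ x → pmN x m k) (x-[1+x+e]≡-[1+e] (+ n) (+ e))
  where
  x-[1+x+e]≡-[1+e] : ∀ x e → x - (+ 1 + x + e) ≡ - (+ 1 + e)
  x-[1+x+e]≡-[1+e] = solve-∀

pmN-stable : ∀ {x K} m → x ℤ.≤ + K → pmN x m K ≡ pm x m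
pmN-stable { -[1+ _ ]} m _         = refl
pmN-stable {+ n}       m (+≤+ n≤K) = cong +_ (pb-stable m n≤K)

pmN-pascal-bound : ∀ x m k →
  pmN x (suc m) (suc k) ≡ pmN x (suc m) k + pmN (x - + suc k) m (suc k)
pmN-pascal-bound -[1+ _ ] m k = refl
pmN-pascal-bound (+ n) m k with suc k ≤? n
... | no k≱n = begin
  + pb n (suc m) (suc k)
    ≡⟨ cong +_ (pb-suc-bound (suc m) (ℕ.≤-pred (≰⇒> k≱n))) ⟩
  + pb n (suc m) k
    ≡⟨ sym (ℤ.+-identityʳ _) ⟩
  + pb n (suc m) k + + 0
    ≡⟨ cong (_+_ (+ pb n (suc m) k)) (sym (pmN-below-zero m (suc k) (≰⇒> k≱n))) ⟩
  + pb n (suc m) k + pmN (+ n - + suc k) m (suc k) ∎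
  where open ≡-Reasoning
... | yes k<n with m≤n⇒∃[o]m+o≡n k<n
...   | r , refl = begin
  + pb (suc k ℕ.+ r) (suc m) (suc k)
    ≡⟨ cong +_ (pb-pascal-bound r m k) ⟩
  + pb (suc k ℕ.+ r) (suc m) k + pmN (+ r) m (suc k)
    ≡⟨ cong (λ x → + pb (suc k ℕ.+ r) (suc m) k + pmN x m (suc k)) (sym ([a+b]-a≡b (+ suc k) (+ r))) ⟩
  + pb (suc k ℕ.+ r) (suc m) k + pmN (+ (suc k ℕ.+ r) - + suc k) m (suc k) ∎
  where
  open ≡-Reasoning
  [a+b]-a≡b : ∀ a b → a + b - a ≡ b
  [a+b]-a≡b = solve-∀

pmN-no-parts : ∀ x k → pmN x 0 k ≡ pmN x 0 0
pmN-no-parts -[1+ _ ] k       = refl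
pmN-no-parts (+ n)    zero    = refl
pmN-no-parts (+ n)    (suc k) = trans (cong +_ (pb-unfold n 0 k)) (pmN-no-parts (+ n) k)

pmN-no-bound : ∀ x m → pmN x m 0 ≡ pmN x 0 0
pmN-no-bound -[1+ _ ]    m = refl
pmN-no-bound (+ zero)    m = refl
pmN-no-bound (+ (suc n)) m = refl

x-1-n≡x-[1+n] : ∀ x n → x - + 1 - n ≡ x - (+ 1 + n)
x-1-n≡x-[1+n] = solve-∀

-- Fewer than m + 1 parts, or m + 1 parts each lowered by one; pb itself is defined by the
-- recursion in the largest part, pmN-pascal-bound.
pmN-pascal-parts : ∀ x m k →
  pmN x (suc m) (suc k) ≡ pmN x m (suc k) + pmN (x - + suc m) (suc m) k
pmN-pascal-parts x zero zero = begin
  pmN x 1 1                        ≡⟨ pmN-pascal-bound x 0 0 ⟩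
  pmN x 1 0 + pmN (x - + 1) 0 1    ≡⟨ cong₂ _+_ (pmN-no-bound x 1) (pmN-no-parts (x - + 1) 1) ⟩
  pmN x 0 0 + pmN (x - + 1) 0 0    ≡⟨ sym (cong₂ _+_ (pmN-no-parts x 1) (pmN-no-bound (x - + 1) 1)) ⟩
  pmN x 0 1 + pmN (x - + 1) 1 0    ∎
  where open ≡-Reasoning
pmN-pascal-parts x (suc m) zero = begin
  pmN x (2 ℕ.+ m) 1
    ≡⟨ pmN-pascal-bound x (suc m) 0 ⟩
  pmN x (2 ℕ.+ m) 0 + pmN (x - + 1) (suc m) 1
    ≡⟨ cong (_+_ (pmN x (2 ℕ.+ m) 0)) (pmN-pascal-parts (x - + 1) m 0) ⟩
  pmN x (2 ℕ.+ m) 0 + (pmN (x - + 1) m 1 + pmN (x - + 1 - + suc m) (suc m) 0)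
    ≡⟨ sym (ℤ.+-assoc (pmN x (2 ℕ.+ m) 0) _ _) ⟩
  pmN x (2 ℕ.+ m) 0 + pmN (x - + 1) m 1 + pmN (x - + 1 - + suc m) (suc m) 0
    ≡⟨ cong₂ _+_ (sym (trans (pmN-pascal-bound x m 0) (cong (_+ pmN (x - + 1) m 1) no-bound)))
                 no-bound′ ⟩
  pmN x (suc m) 1 + pmN (x - + (2 ℕ.+ m)) (2 ℕ.+ m) 0 ∎
  where
  open ≡-Reasoning
  no-bound : pmN x (suc m) 0 ≡ pmN x (2 ℕ.+ m) 0
  no-bound = trans (pmN-no-bound x (suc m)) (sym (pmN-no-bound x (2 ℕ.+ m)))
  no-bound′ : pmN (x - + 1 - + suc m) (suc m) 0 ≡ pmN (x - + (2 ℕ.+ m)) (2 ℕ.+ m) 0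
  no-bound′ = trans (pmN-no-bound _ (suc m))
                    (trans (cong (λ y → pmN y 0 0) (x-1-n≡x-[1+n] x (+ suc m)))
                           (sym (pmN-no-bound _ (2 ℕ.+ m))))
pmN-pascal-parts x zero (suc k) = begin
  pmN x 1 (2 ℕ.+ k)
    ≡⟨ pmN-pascal-bound x 0 (suc k) ⟩
  pmN x 1 (suc k) + pmN (x - + (2 ℕ.+ k)) 0 (2 ℕ.+ k)
    ≡⟨ cong (_+ pmN (x - + (2 ℕ.+ k)) 0 (2 ℕ.+ k)) (pmN-pascal-parts x 0 k) ⟩
  pmN x 0 (suc k) + pmN (x - + 1) 1 k + pmN (x - + (2 ℕ.+ k)) 0 (2 ℕ.+ k)
    ≡⟨ ℤ.+-assoc (pmN x 0 (suc k)) _ _ ⟩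
  pmN x 0 (suc k) + (pmN (x - + 1) 1 k + pmN (x - + (2 ℕ.+ k)) 0 (2 ℕ.+ k))
    ≡⟨ cong₂ _+_ no-parts
                 (sym (trans (pmN-pascal-bound (x - + 1) 0 k) (cong (_+_ (pmN (x - + 1) 1 k)) no-parts′))) ⟩
  pmN x 0 (2 ℕ.+ k) + pmN (x - + 1) 1 (suc k) ∎
  where
  open ≡-Reasoning
  no-parts : pmN x 0 (suc k) ≡ pmN x 0 (2 ℕ.+ k)
  no-parts = trans (pmN-no-parts x (suc k)) (sym (pmN-no-parts x (2 ℕ.+ k)))
  no-parts′ : pmN (x - + 1 - + suc k) 0 (suc k) ≡ pmN (x - + (2 ℕ.+ k)) 0 (2 ℕ.+ k)
  no-parts′ = trans (pmN-no-parts _ (suc k))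
                    (trans (cong (λ y → pmN y 0 0) (x-1-n≡x-[1+n] x (+ suc k)))
                           (sym (pmN-no-parts _ (2 ℕ.+ k))))
pmN-pascal-parts x (suc m) (suc k) = begin
  pmN x (2 ℕ.+ m) (2 ℕ.+ k)
    ≡⟨ pmN-pascal-bound x (suc m) (suc k) ⟩
  pmN x (2 ℕ.+ m) (suc k) + pmN (x - + (2 ℕ.+ k)) (suc m) (2 ℕ.+ k)
    ≡⟨ cong₂ _+_ (pmN-pascal-parts x (suc m) k) (pmN-pascal-parts (x - + (2 ℕ.+ k)) m (suc k)) ⟩
  (A + B) + (C + pmN (x - + (2 ℕ.+ k) - + suc m) (suc m) (suc k))
    ≡⟨ cong (λ y → (A + B) + (C + pmN y (suc m) (suc k))) (x-[1+a]-b≡x-[1+b]-a x (+ suc k) (+ suc m)) ⟩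
  (A + B) + (C + D)
    ≡⟨ interchange A B C D ⟩
  (A + C) + (B + D)
    ≡⟨ sym (cong₂ _+_ (pmN-pascal-bound x m (suc k)) (pmN-pascal-bound (x - + (2 ℕ.+ m)) (suc m) k)) ⟩
  pmN x (suc m) (2 ℕ.+ k) + pmN (x - + (2 ℕ.+ m)) (2 ℕ.+ m) (suc k) ∎
  where
  open ≡-Reasoning
  A B C D : ℤ
  A = pmN x (suc m) (suc k)
  B = pmN (x - + (2 ℕ.+ m)) (2 ℕ.+ m) k
  C = pmN (x - + (2 ℕ.+ k)) m (2 ℕ.+ k)
  D = pmN (x - + (2 ℕ.+ m) - + suc k) (suc m) (suc k)
  x-[1+a]-b≡x-[1+b]-a : ∀ x a b → x - (+ 1 + a) - b ≡ x - (+ 1 + b) - a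
  x-[1+a]-b≡x-[1+b]-a = solve-∀

pm-pascal : ∀ x m → pm x (suc m) ≡ pm x m + pm (x - + suc m) (suc m)
pm-pascal -[1+ _ ] m = refl
pm-pascal (+ n)    m = begin
  pm (+ n) (suc m)
    ≡⟨ sym (pmN-stable (suc m) (+≤+ (n≤1+n n))) ⟩
  pmN (+ n) (suc m) (suc n)
    ≡⟨ pmN-pascal-parts (+ n) m n ⟩
  pmN (+ n) m (suc n) + pmN (+ n - + suc m) (suc m) n
    ≡⟨ cong₂ _+_ (pmN-stable m (+≤+ (n≤1+n n))) (pmN-stable (suc m) (ℤ.i-j≤i (+ n) (+ suc m))) ⟩
  pm (+ n) m + pm (+ n - + suc m) (suc m) ∎
  where open ≡-Reasoning

-- Partitions whose largest part exceeds N

cumulative : ℕ → ℤ → ℤ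
cumulative m -[1+ _ ]  = + 0
cumulative m (+ zero)  = + 0
cumulative m (+ suc s) = cumulative m (+ s) + pm (+ s) m

cumulative-suc : ∀ m y → cumulative m (+ 1 + y) ≡ cumulative m y + pm y m
cumulative-suc m (+ n)        = refl
cumulative-suc m -[1+ zero ]  = refl
cumulative-suc m -[1+ suc n ] = refl

cumulative-nonpos : ∀ {y} m → y ℤ.≤ + 0 → cumulative m y ≡ + 0
cumulative-nonpos { -[1+ _ ]} m _        = refl
cumulative-nonpos {+ zero}    m _        = refl
cumulative-nonpos {+ suc _}   m (+≤+ ())

1+[x-[1+n]]≡x-n : ∀ x n → + 1 + (x - (+ 1 + n)) ≡ x - n
1+[x-[1+n]]≡x-n = solve-∀

-- Raising the bound from N to N + 1 admits the partitions with largest part N + 1; the rest of such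
-- a partition is at most x − (N + 1) ≤ N + 1, so it is an unrestricted partition into ≤ m parts.
pmN-suc-bound-cumulative : ∀ {x} m N → x ℤ.≤ + 2 * + N + + 2 →
  pmN x (suc m) (suc N) + cumulative m (x - + suc N) ≡ pmN x (suc m) N + cumulative m (x - + N)
pmN-suc-bound-cumulative {x} m N x≤2N+2 = begin
  pmN x (suc m) (suc N) + C
    ≡⟨ cong (_+ C) (pmN-pascal-bound x m N) ⟩
  pmN x (suc m) N + pmN (x - + suc N) m (suc N) + C
    ≡⟨ cong (λ c → pmN x (suc m) N + c + C) (pmN-stable m x-[1+N]≤1+N) ⟩
  pmN x (suc m) N + pm (x - + suc N) m + C
    ≡⟨ xy∙z≈x∙zy (pmN x (suc m) N) _ C ⟩
  pmN x (suc m) N + (C + pm (x - + suc N) m)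
    ≡⟨ cong (_+_ (pmN x (suc m) N)) (sym (cumulative-suc m (x - + suc N))) ⟩
  pmN x (suc m) N + cumulative m (+ 1 + (x - + suc N))
    ≡⟨ cong (λ y → pmN x (suc m) N + cumulative m y) (1+[x-[1+n]]≡x-n x (+ N)) ⟩
  pmN x (suc m) N + cumulative m (x - + N) ∎
  where
  open ≡-Reasoning
  C : ℤ
  C = cumulative m (x - + suc N)
  [2n+2]-[1+n]≡1+n : ∀ n → + 2 * n + + 2 - (+ 1 + n) ≡ + 1 + n
  [2n+2]-[1+n]≡1+n = solve-∀
  x-[1+N]≤1+N : x - + suc N ℤ.≤ + suc N
  x-[1+N]≤1+N = ℤ.≤-trans (ℤ.+-monoˡ-≤ (- + suc N) x≤2N+2)
                          (ℤ.≤-reflexive ([2n+2]-[1+n]≡1+n (+ N)))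

pm-by-largest-part : ∀ {x} m N → x ℤ.≤ + 2 * + N + + 2 →
  pm x (suc m) ≡ pmN x (suc m) N + cumulative m (x - + N)
pm-by-largest-part {x} m N x≤2N+2 = begin
  pm x (suc m)
    ≡⟨ sym (ℤ.+-identityʳ _) ⟩
  pm x (suc m) + + 0
    ≡⟨ sym (cong₂ _+_ (pmN-stable (suc m) x≤K) (cumulative-nonpos m (ℤ.i≤j⇒i-j≤0 x≤K))) ⟩
  pmN x (suc m) K + cumulative m (x - + K)
    ≡⟨ telescope (2 ℕ.+ N) ⟩
  pmN x (suc m) N + cumulative m (x - + N) ∎
  where
  open ≡-Reasoning
  K : ℕ
  K = (2 ℕ.+ N) ℕ.+ N
  2n+2≡2+n+n : ∀ n → + 2 * n + + 2 ≡ + 2 + n + n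
  2n+2≡2+n+n = solve-∀
  x≤K : x ℤ.≤ + K
  x≤K = ℤ.≤-trans x≤2N+2 (ℤ.≤-reflexive (2n+2≡2+n+n (+ N)))
  x≤2[d+N]+2 : ∀ d → x ℤ.≤ + 2 * + (d ℕ.+ N) + + 2
  x≤2[d+N]+2 d =
    ℤ.≤-trans x≤2N+2 (ℤ.+-monoˡ-≤ (+ 2) (ℤ.*-monoˡ-≤-nonNeg (+ 2) (+≤+ (m≤n+m N d))))
  telescope : ∀ d → pmN x (suc m) (d ℕ.+ N) + cumulative m (x - + (d ℕ.+ N))
                  ≡ pmN x (suc m) N + cumulative m (x - + N)
  telescope zero    = refl
  telescope (suc d) = trans (pmN-suc-bound-cumulative m (d ℕ.+ N) (x≤2[d+N]+2 d)) (telescope d)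

ΔpN-by-largest-part : ∀ {x} m N → x ℤ.≤ + 2 * + N + + 2 →
  ΔpN (+ 1) x (suc m) N ≡ Δp (+ 1) x (suc m) - pm (x - + suc N) m
ΔpN-by-largest-part {x} m N x≤2N+2 = begin
  pmN x (suc m) N - pmN (x - + 1) (suc m) N
    ≡⟨ cancel (pmN x (suc m) N) (pmN (x - + 1) (suc m) N) C c ⟩
  (pmN x (suc m) N + (C + c)) - (pmN (x - + 1) (suc m) N + C) - c
    ≡⟨ sym (cong₂ (λ u v → u - v - c) split-at-x split-at-x-1) ⟩
  pm x (suc m) - pm (x - + 1) (suc m) - c ∎
  where
  open ≡-Reasoning
  C c : ℤ
  C = cumulative m (x - + suc N)
  c = pm (x - + suc N) m
  cancel : ∀ a b C c → a - b ≡ (a + (C + c)) - (b + C) - c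
  cancel = solve-∀
  split-at-x : pm x (suc m) ≡ pmN x (suc m) N + (C + c)
  split-at-x = trans (pm-by-largest-part m N x≤2N+2)
    (cong (_+_ (pmN x (suc m) N))
          (trans (cong (cumulative m) (sym (1+[x-[1+n]]≡x-n x (+ N)))) (cumulative-suc m (x - + suc N))))
  split-at-x-1 : pm (x - + 1) (suc m) ≡ pmN (x - + 1) (suc m) N + C
  split-at-x-1 = trans (pm-by-largest-part m N (ℤ.≤-trans (ℤ.i-j≤i x (+ 1)) x≤2N+2))
    (cong (λ y → pmN (x - + 1) (suc m) N + cumulative m y) (x-1-n≡x-[1+n] x (+ N)))

-- Δp(·, m) at even and odd arguments

Δp-pascal : ∀ a x m → Δp a x (suc m) ≡ Δp a x m + Δp a (x - + suc m) (suc m)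
Δp-pascal a x m = begin
  pm x (suc m) - pm (x - a) (suc m)
    ≡⟨ cong₂ _-_ (pm-pascal x m) (pm-pascal (x - a) m) ⟩
  (pm x m + pm (x - + suc m) (suc m)) - (pm (x - a) m + pm (x - a - + suc m) (suc m))
    ≡⟨ cong (λ y → (pm x m + pm (x - + suc m) (suc m)) - (pm (x - a) m + pm y (suc m)))
            (x-a-b≡x-b-a x a (+ suc m)) ⟩
  (pm x m + pm (x - + suc m) (suc m)) - (pm (x - a) m + pm (x - + suc m - a) (suc m))
    ≡⟨ [a+b]-[c+d]≡[a-c]+[b-d] (pm x m) (pm (x - + suc m) (suc m)) (pm (x - a) m) _ ⟩
  Δp a x m + Δp a (x - + suc m) (suc m) ∎
  where
  open ≡-Reasoning
  x-a-b≡x-b-a : ∀ x a b → x - a - b ≡ x - b - a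
  x-a-b≡x-b-a = solve-∀
  [a+b]-[c+d]≡[a-c]+[b-d] : ∀ a b c d → (a + b) - (c + d) ≡ (a - c) + (b - d)
  [a+b]-[c+d]≡[a-c]+[b-d] = solve-∀

Δp-self : ∀ x m → Δp (+ suc m) x (suc m) ≡ pm x m
Δp-self x m = trans (cong (_- pm (x - + suc m) (suc m)) (pm-pascal x m)) ([a+b]-b≡a _ _)
  where
  [a+b]-b≡a : ∀ a b → a + b - b ≡ a
  [a+b]-b≡a = solve-∀

pm-double-no-parts : ∀ y → pm (+ 2 * y) 0 ≡ pm y 0
pm-double-no-parts -[1+ _ ]    = refl
pm-double-no-parts (+ zero)    = refl
pm-double-no-parts (+ (suc n)) =
  cong +_ (trans (pb-no-parts (n ℕ.+ 1 ℕ.* suc n) (2 ℕ.* suc n)) (sym (pb-no-parts n (suc n))))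

pm-odd-no-parts : ∀ y → pm (+ 2 * y - + 1) 0 ≡ + 0
pm-odd-no-parts -[1+ _ ]    = refl
pm-odd-no-parts (+ zero)    = refl
pm-odd-no-parts (+ (suc n)) =
  trans (cong (λ x → pm x 0) (trans (2[1+y]-1≡1+2y (+ n)) (cong (_+_ (+ 1)) (sym (ℤ.pos-* 2 n)))))
        (cong +_ (pb-no-parts (2 ℕ.* n) (suc (2 ℕ.* n))))
  where
  2[1+y]-1≡1+2y : ∀ y → + 2 * (+ 1 + y) - + 1 ≡ + 1 + + 2 * y
  2[1+y]-1≡1+2y = solve-∀

ℤ-induction₂ : (P : ℤ → Set) → (∀ n → P -[1+ n ]) → (∀ y → P (y - + 2) → P (y - + 1) → P y) →
               ∀ y → P y
ℤ-induction₂ P neg step -[1+ n ] = neg n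
ℤ-induction₂ P neg step (+ n)    = proj₂ (upTo n)
  where
  y-1≡1+y-2 : ∀ y → y - + 1 ≡ + 1 + y - + 2
  y-1≡1+y-2 = solve-∀
  upTo : ∀ n → P (+ n - + 1) × P (+ n)
  upTo zero    = neg 0 , step (+ 0) (neg 1) (neg 0)
  upTo (suc n) with upTo n
  ... | Pn-1 , Pn = Pn , step (+ suc n) (subst P (y-1≡1+y-2 (+ n)) Pn-1) Pn

2y-2c≡2[y-c] : ∀ y c → + 2 * y - + 2 * c ≡ + 2 * (y - c)
2y-2c≡2[y-c] = solve-∀

2y-1-2c≡2[y-c]-1 : ∀ y c → + 2 * y - + 1 - + 2 * c ≡ + 2 * (y - c) - + 1
2y-1-2c≡2[y-c]-1 = solve-∀

-- For negative y every argument of pm below is negative, so the base case holds by computation.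
Δ₁p₂-parity : ∀ y → Δp (+ 1) (+ 2 * y) 2 ≡ pm y 1 × Δp (+ 1) (+ 2 * y - + 1) 2 ≡ + 0
Δ₁p₂-parity = ℤ-induction₂ _ (λ _ → refl , refl) λ y _ (even₋₁ , odd₋₁) →
  (begin
    Δp (+ 1) (+ 2 * y) 2
      ≡⟨ Δp-pascal (+ 1) (+ 2 * y) 1 ⟩
    Δp (+ 1) (+ 2 * y) 1 + Δp (+ 1) (+ 2 * y - + 2) 2
      ≡⟨ cong₂ _+_ (Δp-self (+ 2 * y) 0) (cong (λ x → Δp (+ 1) x 2) (2y-2c≡2[y-c] y (+ 1))) ⟩
    pm (+ 2 * y) 0 + Δp (+ 1) (+ 2 * (y - + 1)) 2
      ≡⟨ cong₂ _+_ (pm-double-no-parts y) even₋₁ ⟩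
    pm y 0 + pm (y - + 1) 1
      ≡⟨ sym (pm-pascal y 0) ⟩
    pm y 1 ∎) ,
  (begin
    Δp (+ 1) (+ 2 * y - + 1) 2
      ≡⟨ Δp-pascal (+ 1) (+ 2 * y - + 1) 1 ⟩
    Δp (+ 1) (+ 2 * y - + 1) 1 + Δp (+ 1) (+ 2 * y - + 1 - + 2) 2
      ≡⟨ cong₂ _+_ (Δp-self (+ 2 * y - + 1) 0)
                   (cong (λ x → Δp (+ 1) x 2) (2y-1-2c≡2[y-c]-1 y (+ 1))) ⟩
    pm (+ 2 * y - + 1) 0 + Δp (+ 1) (+ 2 * (y - + 1) - + 1) 2
      ≡⟨ cong₂ _+_ (pm-odd-no-parts y) odd₋₁ ⟩
    + 0 ∎)
  where open ≡-Reasoning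

Δ₁p₃-parity : ∀ y → Δp (+ 1) (+ 2 * y) 3 ≡ Δp (+ 2) y 3
                  × Δp (+ 1) (+ 2 * y - + 1) 3 ≡ Δp (+ 2) (y - + 2) 3
Δ₁p₃-parity = ℤ-induction₂ _ (λ _ → refl , refl) λ y (even₋₂ , _) (_ , odd₋₁) →
  (begin
    Δp (+ 1) (+ 2 * y) 3
      ≡⟨ Δp-pascal (+ 1) (+ 2 * y) 2 ⟩
    Δp (+ 1) (+ 2 * y) 2 + Δp (+ 1) (+ 2 * y - + 3) 3
      ≡⟨ cong₂ _+_ (proj₁ (Δ₁p₂-parity y)) (cong (λ x → Δp (+ 1) x 3) (2y-3≡2[y-1]-1 y)) ⟩
    pm y 1 + Δp (+ 1) (+ 2 * (y - + 1) - + 1) 3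
      ≡⟨ cong₂ _+_ (sym (Δp-self y 1)) (trans odd₋₁ (cong (λ x → Δp (+ 2) x 3) (y-1-2≡y-3 y))) ⟩
    Δp (+ 2) y 2 + Δp (+ 2) (y - + 3) 3
      ≡⟨ sym (Δp-pascal (+ 2) y 2) ⟩
    Δp (+ 2) y 3 ∎) ,
  (begin
    Δp (+ 1) (+ 2 * y - + 1) 3
      ≡⟨ Δp-pascal (+ 1) (+ 2 * y - + 1) 2 ⟩
    Δp (+ 1) (+ 2 * y - + 1) 2 + Δp (+ 1) (+ 2 * y - + 1 - + 3) 3
      ≡⟨ cong₂ _+_ (proj₂ (Δ₁p₂-parity y)) (cong (λ x → Δp (+ 1) x 3) (2y-1-3≡2[y-2] y)) ⟩
    + 0 + Δp (+ 1) (+ 2 * (y - + 2)) 3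
      ≡⟨ trans (ℤ.+-identityˡ _) even₋₂ ⟩
    Δp (+ 2) (y - + 2) 3 ∎)
  where
  open ≡-Reasoning
  2y-3≡2[y-1]-1 : ∀ y → + 2 * y - + 3 ≡ + 2 * (y - + 1) - + 1
  2y-3≡2[y-1]-1 = solve-∀
  2y-1-3≡2[y-2] : ∀ y → + 2 * y - + 1 - + 3 ≡ + 2 * (y - + 2)
  2y-1-3≡2[y-2] = solve-∀
  y-1-2≡y-3 : ∀ y → y - + 1 - + 2 ≡ y - + 3
  y-1-2≡y-3 = solve-∀

Δ₁p₄-parity : ∀ y → Δp (+ 1) (+ 2 * y) 4 ≡ pm y 3 × Δp (+ 1) (+ 2 * y - + 1) 4 ≡ pm (y - + 2) 3
Δ₁p₄-parity = ℤ-induction₂ _ (λ _ → refl , refl) λ y (even₋₂ , odd₋₂) _ →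
  (begin
    Δp (+ 1) (+ 2 * y) 4
      ≡⟨ Δp-pascal (+ 1) (+ 2 * y) 3 ⟩
    Δp (+ 1) (+ 2 * y) 3 + Δp (+ 1) (+ 2 * y - + 4) 4
      ≡⟨ cong₂ _+_ (proj₁ (Δ₁p₃-parity y))
                   (trans (cong (λ x → Δp (+ 1) x 4) (2y-2c≡2[y-c] y (+ 2))) even₋₂) ⟩
    pm y 3 - pm (y - + 2) 3 + pm (y - + 2) 3
      ≡⟨ a-b+b≡a _ _ ⟩
    pm y 3 ∎) ,
  (begin
    Δp (+ 1) (+ 2 * y - + 1) 4
      ≡⟨ Δp-pascal (+ 1) (+ 2 * y - + 1) 3 ⟩
    Δp (+ 1) (+ 2 * y - + 1) 3 + Δp (+ 1) (+ 2 * y - + 1 - + 4) 4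
      ≡⟨ cong₂ _+_ (proj₂ (Δ₁p₃-parity y))
                   (trans (cong (λ x → Δp (+ 1) x 4) (2y-1-2c≡2[y-c]-1 y (+ 2))) odd₋₂) ⟩
    pm (y - + 2) 3 - pm (y - + 2 - + 2) 3 + pm (y - + 2 - + 2) 3
      ≡⟨ a-b+b≡a _ _ ⟩
    pm (y - + 2) 3 ∎)
  where
  open ≡-Reasoning
  a-b+b≡a : ∀ a b → a - b + b ≡ a
  a-b+b≡a = solve-∀

2y≤2N+2 : ∀ {y} N → y ℤ.≤ + N + + 1 → + 2 * y ℤ.≤ + 2 * + N + + 2
2y≤2N+2 {y} N y≤N+1 =
  ℤ.≤-trans (ℤ.*-monoˡ-≤-nonNeg (+ 2) y≤N+1) (ℤ.≤-reflexive (2[n+1]≡2n+2 (+ N)))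
  where
  2[n+1]≡2n+2 : ∀ n → + 2 * (n + + 1) ≡ + 2 * n + + 2
  2[n+1]≡2n+2 = solve-∀

ΔpN₄-even : ∀ N y → y ℤ.≤ + N + + 1 →
  ΔpN (+ 1) (+ 2 * y) 4 N ≡ pm y 3 - pm (+ 2 * y - + suc N) 3
ΔpN₄-even N y y≤N+1 = trans (ΔpN-by-largest-part 3 N (2y≤2N+2 N y≤N+1))
                            (cong (_- pm (+ 2 * y - + suc N) 3) (proj₁ (Δ₁p₄-parity y)))

ΔpN₄-odd : ∀ N y → y ℤ.≤ + N + + 1 →
  ΔpN (+ 1) (+ 2 * y - + 1) 4 N ≡ pm (y - + 2) 3 - pm (+ 2 * y - + 1 - + suc N) 3
ΔpN₄-odd N y y≤N+1 =
  trans (ΔpN-by-largest-part 3 N (ℤ.≤-trans (ℤ.i-j≤i (+ 2 * y) (+ 1)) (2y≤2N+2 N y≤N+1)))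
        (cong (_- pm (+ 2 * y - + 1 - + suc N) 3) (proj₂ (Δ₁p₄-parity y)))

proposition4p4 : (N a : ℕ) →
    (ΔpN (+ 1) (+ 2 * + N - + 2 * + a) 4 N ≡ Δp (+ a + + 1) (+ N - + a) 3)
    × (ΔpN (+ 1) (+ 2 * + N - (+ 2 * + a + + 1)) 4 N ≡ Δp (+ a) (+ N - + 2 - + a) 3)
proposition4p4 N a = even , odd
  where
  open ≡-Reasoning
  y : ℤ
  y = + N - + a
  y≤N+1 : y ℤ.≤ + N + + 1
  y≤N+1 = ℤ.≤-trans (ℤ.i-j≤i (+ N) (+ a)) (ℤ.i≤i+j (+ N) (+ 1))
  even : ΔpN (+ 1) (+ 2 * + N - + 2 * + a) 4 N ≡ Δp (+ a + + 1) y 3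
  even = begin
    ΔpN (+ 1) (+ 2 * + N - + 2 * + a) 4 N
      ≡⟨ cong (λ x → ΔpN (+ 1) x 4 N) (2y-2c≡2[y-c] (+ N) (+ a)) ⟩
    ΔpN (+ 1) (+ 2 * y) 4 N
      ≡⟨ ΔpN₄-even N y y≤N+1 ⟩
    pm y 3 - pm (+ 2 * y - + suc N) 3
      ≡⟨ cong (λ x → pm y 3 - pm x 3) (2[n-a]-[1+n]≡n-a-[a+1] (+ N) (+ a)) ⟩
    Δp (+ a + + 1) y 3 ∎
    where
    2[n-a]-[1+n]≡n-a-[a+1] : ∀ n a → + 2 * (n - a) - (+ 1 + n) ≡ n - a - (a + + 1)
    2[n-a]-[1+n]≡n-a-[a+1] = solve-∀
  odd : ΔpN (+ 1) (+ 2 * + N - (+ 2 * + a + + 1)) 4 N ≡ Δp (+ a) (+ N - + 2 - + a) 3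
  odd = begin
    ΔpN (+ 1) (+ 2 * + N - (+ 2 * + a + + 1)) 4 N
      ≡⟨ cong (λ x → ΔpN (+ 1) x 4 N) (2n-[2a+1]≡2[n-a]-1 (+ N) (+ a)) ⟩
    ΔpN (+ 1) (+ 2 * y - + 1) 4 N
      ≡⟨ ΔpN₄-odd N y y≤N+1 ⟩
    pm (y - + 2) 3 - pm (+ 2 * y - + 1 - + suc N) 3
      ≡⟨ cong₂ (λ u v → pm u 3 - pm v 3) (n-a-2≡n-2-a (+ N) (+ a))
                                         (2[n-a]-1-[1+n]≡n-2-a-a (+ N) (+ a)) ⟩
    Δp (+ a) (+ N - + 2 - + a) 3 ∎
    where
    2n-[2a+1]≡2[n-a]-1 : ∀ n a → + 2 * n - (+ 2 * a + + 1) ≡ + 2 * (n - a) - + 1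
    2n-[2a+1]≡2[n-a]-1 = solve-∀
    n-a-2≡n-2-a : ∀ n a → n - a - + 2 ≡ n - + 2 - a
    n-a-2≡n-2-a = solve-∀
    2[n-a]-1-[1+n]≡n-2-a-a : ∀ n a → + 2 * (n - a) - + 1 - (+ 1 + n) ≡ n - + 2 - a - a
    2[n-a]-1-[1+n]≡n-2-a-a = solve-∀
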